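{- There is no coproduct $\delta^{(\subset,\cap)}$ on $\mathcal{F}[\mathbf{H}]$ satisfying simultaneously: (1) $(\mathcal{F}[\mathbf{H}],m,\Delta^{(\subset,\cap)},\delta^{(\subset,\cap)})$ is a double bialgebra; (2) the counit of $\delta^{(\subset,\cap)}$ is $\epsilon_\delta$; (3) the character $\lambda_0$ is invertible for the convolution $\star$ associated to $\delta^{(\subset,\cap)}$ and $\lambda_0^{\star-1}(G)\in\mathbb{Z}$ for every hypergraph $G$; (4) for every hypergraph $G$, $\delta^{(\subset,\cap)}(G)=\sum_{G_1,G_2}a_{G_1,G_2}(G)\,G_1\otimes G_2$ (sum over isomorphism classes of hypergraphs) with all $a_{G_1,G_2}(G)\in\mathbb{Z}$.
   Context: $\mathbb{K}$ is a field of characteristic zero. A hypergraph is a pair $G=(V(G),E(G))$ with $V(G)$ finite and $E(G)\subseteq\mathcal{P}(V(G))$ containing $\emptyset$ and all singletons. For $I\subseteq V(G)$: $G_{\mid_\subset I}$ has vertex set $I$ and edges $\{e\in E(G)\mid e\subseteq I\}$; $G_{\mid_\cap I}$ has vertex set $I$ and edges $\{e\cap I\mid e\in E(G)\}$. $\mathcal{F}[\mathbf{H}]$ is the $\mathbb{K}$-vector space with basis the isomorphism classes of hypergraphs, with product $m$ the disjoint union and coproduct $\Delta^{(\subset,\cap)}(G)=\sum_{I\subseteq V(G)}G_{\mid_\subset I}\otimes G_{\mid_\cap V(G)\setminus I}$ (counit $\varepsilon(G)=1$ iff $G$ is empty). $\epsilon_\delta(G)=1$ if $G$ has no edge of cardinality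 $\geq2$ and $0$ otherwise; $\lambda_0$ is the character with $\lambda_0(G)=1$ for all hypergraphs $G$. A double bialgebra $(A,m,\Delta,\delta)$ is an algebra with two coproducts such that $(A,m,\delta)$ is a bialgebra (counit $\epsilon_\delta$), $(A,m,\Delta)$ is a bialgebra (counit $\varepsilon_\Delta$), $(\Delta\otimes\mathrm{Id})\circ\delta=m_{1,3,24}\circ(\delta\otimes\delta)\circ\Delta$ with $m_{1,3,24}(a_1\otimes a_2\otimes a_3\otimes a_4)=a_1\otimes a_3\otimes a_2a_4$, and $(\varepsilon_\Delta\otimes\mathrm{Id})\circ\delta=1_A\,\varepsilon_\Delta$. The convolution of linear forms associated to $\delta$ is $f\star g=(f\otimes g)\circ\delta$. -}

module Defs where

open import Level using (Level; _⊔_)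
open import Data.Bool using (Bool; true; false; _∧_; _∨_; not; if_then_else_)
import Data.Bool as B
open import Data.Nat using (ℕ; zero; suc; _≤ᵇ_; _≟_) renaming (_+_ to _+ℕ_)
open import Data.Integer using (ℤ; +_; -[1+_])
open import Data.Fin using (Fin)
import Data.Fin as F
open import Data.Fin.Subset using (Subset; ∁)
open import Data.Vec using (Vec; []; _∷_; lookup; tabulate; take; drop)
open import Data.List using (List; []; _∷_; map; concatMap; allFin; foldr; _++_)
open import Data.Bool.ListAction using (any; all)
open import Data.Product using (_×_; _,_; Σ; ∃)
open import Relation.Nullary using (¬_; does; yes; no)
open import Relation.Binary.PropositionalEquality using (_≡_; refl)
open import Algebra.Bundles using (CommutativeRing)

record Field (c ℓ : Level) : Set (Level.suc (c ⊔ ℓ)) where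
  field
    commRing   : CommutativeRing c ℓ
  open CommutativeRing commRing public
  field
    0≉1        : ¬ (0# ≈ 1#)
    invertible : ∀ x → ¬ (x ≈ 0#) → ∃ λ y → x * y ≈ 1#

module FieldOps {c ℓ} (K : Field c ℓ) where
  open Field K

  fromℕ : ℕ → Carrier
  fromℕ zero    = 0#
  fromℕ (suc n) = 1# + fromℕ n

  fromℤ : ℤ → Carrier
  fromℤ (+ n)      = fromℕ n
  fromℤ -[1+ n ]   = - fromℕ (suc n)

  IsInteger : Carrier → Set ℓ
  IsInteger x = ∃ λ (z : ℤ) → x ≈ fromℤ z

CharacteristicZero : ∀ {c ℓ} → Field c ℓ → Set ℓ
CharacteristicZero K = ∀ (n : ℕ) → ¬ (fromℕ (suc n) ≈ 0#)
  where open Field K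
        open FieldOps K

eqB : Bool → Bool → Bool
eqB a b = does (a B.≟ b)

eqFin : ∀ {n} → Fin n → Fin n → Bool
eqFin i j = does (i F.≟ j)

eqSub : ∀ {n} → Subset n → Subset n → Bool
eqSub []       []       = true
eqSub (a ∷ as) (b ∷ bs) = eqB a b ∧ eqSub as bs

sz : ∀ {n} → Subset n → ℕ
sz []          = 0
sz (true ∷ s)  = suc (sz s)
sz (false ∷ s) = sz s

allSubsets : ∀ n → List (Subset n)
allSubsets zero    = [] ∷ []
allSubsets (suc n) = map (true ∷_) (allSubsets n) ++ map (false ∷_) (allSubsets n)

-- a subset I of Fin n has sz I elements; sel I S = S ∩ I seen inside Fin (sz I)
sel : ∀ {n} (I : Subset n) → Subset n → Subset (sz I)
sel []          []       = []
sel (true ∷ I)  (b ∷ S)  = b ∷ sel I S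
sel (false ∷ I) (b ∷ S)  = sel I S

ext : ∀ {n} (I : Subset n) → Subset (sz I) → Subset n
ext []          []       = []
ext (true ∷ I)  (b ∷ T)  = b ∷ ext I T
ext (false ∷ I) T        = false ∷ ext I T

-- Its edge set is
-- { S | raw S = true } ∪ { S | ∣S∣ ≤ 1 }, so ∅ and all singletons are
-- always edges and every hypergraph in the sense of the paper arises.

record Hyp : Set where
  constructor hyp
  field
    n   : ℕ
    raw : Subset n → Bool
open Hyp public

isEdge : (G : Hyp) → Subset (n G) → Bool
isEdge G S = raw G S ∨ (sz S ≤ᵇ 1)

allMaps : ∀ k m → List (Vec (Fin m) k)
allMaps zero    m = [] ∷ []
allMaps (suc k) m = concatMap (λ i → map (i ∷_) (allMaps k m)) (allFin m)

injectiveᵇ : ∀ {m} → Vec (Fin m) m → Bool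
injectiveᵇ {m} f =
  all (λ i → all (λ j → not (eqFin (lookup f i) (lookup f j)) ∨ eqFin i j) (allFin m)) (allFin m)

image : ∀ {m} → Vec (Fin m) m → Subset m → Subset m
image {m} f S = tabulate (λ j → any (λ i → lookup S i ∧ eqFin (lookup f i) j) (allFin m))

isoᵇ : Hyp → Hyp → Bool
isoᵇ (hyp n E) (hyp m E') with n ≟ m
... | no _    = false
... | yes refl =
  any (λ f → injectiveᵇ f ∧
             all (λ S → eqB (isEdge (hyp n E) S) (isEdge (hyp n E') (image f S))) (allSubsets n))
      (allMaps n n)

_≅_ : Hyp → Hyp → Set
G ≅ H = isoᵇ G H ≡ true

𝟙 : Hyp
𝟙 = hyp 0 (λ _ → false)

_⊔ₕ_ : Hyp → Hyp → Hyp
hyp n E ⊔ₕ hyp m E' =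
  hyp (n +ℕ m) (λ S → (isEdge (hyp n E) (take n S) ∧ eqSub (drop n S) (tabulate (λ _ → false)))
                   ∨ (isEdge (hyp m E') (drop n S) ∧ eqSub (take n S) (tabulate (λ _ → false))))

restr⊂ : (G : Hyp) → Subset (n G) → Hyp
restr⊂ G I = hyp (sz I) (λ T → isEdge G (ext I T))

restr∩ : (G : Hyp) → Subset (n G) → Hyp
restr∩ G I = hyp (sz I) (λ T → any (λ S → isEdge G S ∧ eqSub (sel I S) T) (allSubsets (n G)))

εδᵇ : Hyp → Bool
εδᵇ G = all (λ S → not (isEdge G S) ∨ (sz S ≤ᵇ 1)) (allSubsets (n G))

εΔᵇ : Hyp → Bool
εΔᵇ G = n G ≤ᵇ 0

-- An element of F[H]^{⊗k} is a formal finite sum Σ c · G₁⊗…⊗Gₖ (a list);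
-- two such are equal iff they have the same coefficient on every tuple of
-- isomorphism classes.

module Space {c ℓ} (K : Field c ℓ) where
  open Field K

  [_] : Bool → Carrier
  [ b ] = if b then 1# else 0#

  Σ[_] : ∀ {a} {A : Set a} → List A → (A → Carrier) → Carrier
  Σ[ xs ] f = foldr (λ a r → f a + r) 0# xs

  V₁ V₂ V₃ : Set c
  V₁ = List (Carrier × Hyp)
  V₂ = List (Carrier × Hyp × Hyp)
  V₃ = List (Carrier × Hyp × Hyp × Hyp)

  coeff₁ : V₁ → Hyp → Carrier
  coeff₁ x G = Σ[ x ] (λ { (a , H) → a * [ isoᵇ H G ] })

  coeff₂ : V₂ → Hyp → Hyp → Carrier
  coeff₂ x G₁ G₂ = Σ[ x ] (λ { (a , H₁ , H₂) → a * [ isoᵇ H₁ G₁ ∧ isoᵇ H₂ G₂ ] })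

  coeff₃ : V₃ → Hyp → Hyp → Hyp → Carrier
  coeff₃ x G₁ G₂ G₃ =
    Σ[ x ] (λ { (a , H₁ , H₂ , H₃) → a * [ isoᵇ H₁ G₁ ∧ isoᵇ H₂ G₂ ∧ isoᵇ H₃ G₃ ] })

  _≈₁_ : V₁ → V₁ → Set ℓ
  x ≈₁ y = ∀ G → coeff₁ x G ≈ coeff₁ y G
  _≈₂_ : V₂ → V₂ → Set ℓ
  x ≈₂ y = ∀ G₁ G₂ → coeff₂ x G₁ G₂ ≈ coeff₂ y G₁ G₂
  _≈₃_ : V₃ → V₃ → Set ℓ
  x ≈₃ y = ∀ G₁ G₂ G₃ → coeff₃ x G₁ G₂ G₃ ≈ coeff₃ y G₁ G₂ G₃

  -- a coproduct on F[H] given by its values on (representatives of) basis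
  -- elements; it must only depend on isomorphism classes
  Cop : Set c
  Cop = Hyp → V₂

  WellDefined : Cop → Set ℓ
  WellDefined d = ∀ G G' → G ≅ G' → d G ≈₂ d G'

  -- linear forms on F[H] = functions on isomorphism classes
  LinForm : Set c
  LinForm = Hyp → Carrier

  WellDefinedForm : LinForm → Set ℓ
  WellDefinedForm f = ∀ G G' → G ≅ G' → f G ≈ f G'

  Δ : Cop
  Δ G = map (λ I → (1# , restr⊂ G I , restr∩ G (∁ I))) (allSubsets (n G))

  εδ εΔ : LinForm
  εδ G = [ εδᵇ G ]
  εΔ G = [ εΔᵇ G ]

  λ₀ : LinForm
  λ₀ _ = 1#

  scale₂ : Carrier → V₂ → V₂
  scale₂ a = map (λ { (b , H₁ , H₂) → (a * b , H₁ , H₂) })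

  mul₂ : V₂ → V₂ → V₂
  mul₂ x y = concatMap (λ { (a , G₁ , G₂) →
               map (λ { (b , H₁ , H₂) → (a * b , G₁ ⊔ₕ H₁ , G₂ ⊔ₕ H₂) }) y }) x

  _⊗Id_ : Cop → V₂ → V₃
  (d ⊗Id x) = concatMap (λ { (a , G₁ , G₂) →
                map (λ { (b , H₁ , H₂) → (a * b , H₁ , H₂ , G₂) }) (d G₁) }) x

  Id⊗_∙_ : Cop → V₂ → V₃
  Id⊗ d ∙ x = concatMap (λ { (a , G₁ , G₂) →
                map (λ { (b , H₁ , H₂) → (a * b , G₁ , H₁ , H₂) }) (d G₂) }) x

  _⊗Idε_ : LinForm → V₂ → V₁
  (e ⊗Idε x) = map (λ { (a , G₁ , G₂) → (a * e G₁ , G₂) }) x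

  Idε⊗_∙_ : LinForm → V₂ → V₁
  Idε⊗ e ∙ x = map (λ { (a , G₁ , G₂) → (a * e G₂ , G₁) }) x

  -- m_{1,3,24} ∘ (d ⊗ d) ∘ Δ applied to a basis element G
  m13-24 : Cop → Hyp → V₃
  m13-24 d G = concatMap (λ { (a , A , B) →
                 concatMap (λ { (b , A₁ , A₂) →
                   map (λ { (c' , B₁ , B₂) → (a * b * c' , A₁ , B₁ , A₂ ⊔ₕ B₂) }) (d B) })
                 (d A) }) (Δ G)

  record IsBialgebra (d : Cop) (e : LinForm) : Set (c ⊔ ℓ) where
    field
      coassoc   : ∀ G → (d ⊗Id (d G)) ≈₃ (Id⊗ d ∙ (d G))
      counitˡ   : ∀ G → (e ⊗Idε d G) ≈₁ ((1# , G) ∷ [])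
      counitʳ   : ∀ G → (Idε⊗ e ∙ d G) ≈₁ ((1# , G) ∷ [])
      mult      : ∀ G H → d (G ⊔ₕ H) ≈₂ mul₂ (d G) (d H)
      unit      : d 𝟙 ≈₂ ((1# , 𝟙 , 𝟙) ∷ [])
      ε-mult    : ∀ G H → e (G ⊔ₕ H) ≈ e G * e H
      ε-unit    : e 𝟙 ≈ 1#

  record IsDoubleBialgebra (d : Cop) (e : LinForm) : Set (c ⊔ ℓ) where
    field
      bialg-d   : IsBialgebra d e
      bialg-Δ   : IsBialgebra Δ εΔ
      compat    : ∀ G → (Δ ⊗Id (d G)) ≈₃ m13-24 d G
      εΔ-compat : ∀ G → (εΔ ⊗Idε d G) ≈₁ ((εΔ G , 𝟙) ∷ [])

  conv : Cop → LinForm → LinForm → LinForm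
  conv d f g G = Σ[ d G ] (λ { (a , G₁ , G₂) → a * f G₁ * g G₂ })

  record Conditions (d : Cop) : Set (c ⊔ ℓ) where
    open FieldOps K
    field
      welldef   : WellDefined d
      double    : IsDoubleBialgebra d εδ
      inv       : LinForm
      inv-wd    : WellDefinedForm inv
      inv-left  : ∀ G → conv d λ₀ inv G ≈ εδ G
      inv-right : ∀ G → conv d inv λ₀ G ≈ εδ G
      inv-int   : ∀ G → IsInteger (inv G)
      coeff-int : ∀ G G₁ G₂ → IsInteger (coeff₂ (d G) G₁ G₂)

-- Let μ be the convolution inverse of λ₀ and apply λ₀ ⊗ λ₀ ⊗ μ to both sides of
-- (Δ ⊗ Id) ∘ δ = m₁,₃,₂₄ ∘ (δ ⊗ δ) ∘ Δ at a hypergraph G with at least one vertex.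
-- On the right, multiplicativity of δ and λ₀ ⋆ μ = ε_δ leave the number of I ⊆ V(G) for which
-- G|⊂I ⊔ G|∩(V(G) ∖ I) has no edge of size ≥ 2.  On the left, (λ₀ ⊗ λ₀) ∘ Δ sends H to
-- 2^|V(H)|, which is ε_Δ(H) plus an even number; the ε_Δ part contributes ε_Δ(G) μ(∅) = 0 by
-- the compatibility of ε_Δ with δ, and the rest is twice an integer because μ and the
-- coefficients of δ are integers.  So that number is even, but for the hypergraph on three vertices whose
-- only large edge is the whole vertex set it is 3.

module Submission where

open import Defs
open import Level using (Level; _⊔_)
open import Data.Bool using (Bool; true; false; T; not; _∧_; _∨_)
import Data.Bool as Bool
open import Data.Bool.Properties using (T-∧; T-∨; T-≡; ∧-conicalˡ; ∧-conicalʳ)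
open import Data.Empty using (⊥-elim)
open import Data.Fin using (Fin; punchOut)
import Data.Fin as Fin
open import Data.Fin.Properties using (any?; injective⇒≤; punchOut-injective)
open import Data.Fin.Subset using (Subset; ∁)
open import Data.Integer using (+_; -[1+_])
open import Data.List using (List; []; _∷_; map; concatMap; length; _++_; allFin; filterᵇ)
open import Data.List.Properties using (length-filter; length-++; length-map)
open import Data.List.Membership.Propositional using (_∈_; lose)
open import Data.List.Membership.Propositional.Properties using (∈-allFin; ∈-map⁺; ∈-++⁺ˡ; ∈-++⁺ʳ; ∈-concatMap⁺)
import Data.List.Relation.Unary.All as All
open import Data.List.Relation.Unary.All.Properties using (all⁺; all⁻)
import Data.List.Relation.Unary.Any as Any
open import Data.List.Relation.Unary.Any using (satisfied)
open import Data.List.Relation.Unary.Any.Properties using (any⁺; any⁻)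
open import Data.Maybe using (nothing)
open import Data.Nat using (ℕ; zero; suc; _≤_; s≤s; _≟_) renaming (_+_ to _+ℕ_; _*_ to _*ℕ_)
open import Data.Nat.Properties using (+-suc; suc-injective; ≤-refl; ≤-trans; <-irrefl; ≟-diag)
open import Data.Product using (Σ; ∃; ∃₂; _×_; _,_; proj₁; proj₂; map₁)
open import Data.Sum using (inj₁; inj₂)
open import Data.Unit using (tt)
open import Data.Vec using (Vec; []; _∷_; lookup; tabulate)
open import Data.Vec.Properties using (lookup∘tabulate; tabulate∘lookup; tabulate-cong)
open import Function using (_∘_; _∘′_; const; _⇔_; mk⇔; Equivalence)
open import Function.Definitions using (Injective)
open import Relation.Binary.Structures using (IsEquivalence)
open import Relation.Binary.PropositionalEquality as ≡ using (_≡_; _≢_; cong₂)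
open import Relation.Nullary using (¬_; Dec; yes; no; does; T?)

T-does : ∀ {a} {A : Set a} (d : Dec A) → T (does d) ⇔ A
T-does (yes p) = mk⇔ (const p) (const tt)
T-does (no ¬p) = mk⇔ (λ ()) ¬p

T-not-does : ∀ {a} {A : Set a} (d : Dec A) → T (not (does d)) ⇔ (¬ A)
T-not-does (yes p) = mk⇔ (λ ()) (λ ¬p → ¬p p)
T-not-does (no ¬p) = mk⇔ (const ¬p) (const tt)

T-ext : ∀ {x y : Bool} → (T x → T y) → (T y → T x) → x ≡ y
T-ext {false} {false} _ _ = ≡.refl
T-ext {false} {true}  _ g = ⊥-elim (g tt)
T-ext {true}  {false} f _ = ⊥-elim (f tt)
T-ext {true}  {true}  _ _ = ≡.refl

Subset-ext : ∀ {m} {S S′ : Subset m} →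
             (∀ j → T (lookup S j) → T (lookup S′ j)) → (∀ j → T (lookup S′ j) → T (lookup S j)) → S ≡ S′
Subset-ext {S = S} {S′} to from =
  ≡.trans (≡.sym (tabulate∘lookup S))
          (≡.trans (tabulate-cong (λ j → T-ext (to j) (from j))) (tabulate∘lookup S′))

module Isomorphism where

  open ≡ using (refl; sym; trans; cong; subst)

  VertexMap : ℕ → Set
  VertexMap m = Vec (Fin m) m

  image⁻ : ∀ {m} (f : VertexMap m) S j → T (lookup (image f S) j) → ∃ λ i → T (lookup S i) × lookup f i ≡ j
  image⁻ {m} f S j h
    with i , Si∧fi≡j ← satisfied (any⁻ _ (allFin m) (subst T (lookup∘tabulate _ j) h))
    with Si , fi≡j ← Equivalence.to T-∧ Si∧fi≡j
    = i , Si , Equivalence.to (T-does (lookup f i Fin.≟ j)) fi≡j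

  image⁺ : ∀ {m} (f : VertexMap m) S i → T (lookup S i) → T (lookup (image f S) (lookup f i))
  image⁺ {m} f S i Si = subst T (sym (lookup∘tabulate _ (lookup f i)))
    (any⁺ _ (lose (∈-allFin i) (Equivalence.from T-∧ (Si , Equivalence.from (T-does (lookup f i Fin.≟ lookup f i)) refl))))

  Injectiveᵛ : ∀ {m} → VertexMap m → Set
  Injectiveᵛ f = Injective _≡_ _≡_ (lookup f)

  injectiveᵇ⁻ : ∀ {m} (f : VertexMap m) → T (injectiveᵇ f) → Injectiveᵛ f
  injectiveᵇ⁻ {m} f h {i} {j} fi≡fj
    with Equivalence.to T-∨ (All.lookup (all⁺ _ _ (All.lookup (all⁺ _ _ h) (∈-allFin i))) (∈-allFin j))
  ... | inj₁ fi≢fj = ⊥-elim (Equivalence.to (T-not-does (lookup f i Fin.≟ lookup f j)) fi≢fj fi≡fj)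
  ... | inj₂ i≡j   = Equivalence.to (T-does (i Fin.≟ j)) i≡j

  injectiveᵇ⁺ : ∀ {m} (f : VertexMap m) → Injectiveᵛ f → T (injectiveᵇ f)
  injectiveᵇ⁺ {m} f inj =
    all⁻ _ {allFin m} (All.tabulate (λ {i} _ → all⁻ _ {allFin m} (All.tabulate (λ {j} _ → separates i j))))
    where
    separates : ∀ i j → T (not (eqFin (lookup f i) (lookup f j)) ∨ eqFin i j)
    separates i j with i Fin.≟ j
    ... | yes _   = Equivalence.from T-∨ (inj₂ tt)
    ... | no i≢j  = Equivalence.from T-∨ (inj₁ (Equivalence.from (T-not-does (lookup f i Fin.≟ lookup f j)) (i≢j ∘ inj)))

  ∈-allSubsets : ∀ {m} (S : Subset m) → S ∈ allSubsets m
  ∈-allSubsets [] = Any.here refl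
  ∈-allSubsets (true ∷ S) = ∈-++⁺ˡ (∈-map⁺ (true ∷_) (∈-allSubsets S))
  ∈-allSubsets {suc m} (false ∷ S) = ∈-++⁺ʳ (map (true ∷_) (allSubsets m)) (∈-map⁺ (false ∷_) (∈-allSubsets S))

  ∈-allMaps : ∀ {k m} (f : Vec (Fin m) k) → f ∈ allMaps k m
  ∈-allMaps [] = Any.here refl
  ∈-allMaps {suc k} {m} (i ∷ f) =
    ∈-concatMap⁺ (λ j → map (j ∷_) (allMaps k m)) (Any.map (λ { refl → ∈-map⁺ (i ∷_) (∈-allMaps f) }) (∈-allFin i))

  IsIsomorphism : ∀ {m} (E E′ : Subset m → Bool) → VertexMap m → Set
  IsIsomorphism {m} E E′ f = Injectiveᵛ f × (∀ S → isEdge (hyp m E) S ≡ isEdge (hyp m E′) (image f S))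

  ≅⇒isomorphism : ∀ {n m E E′} → hyp n E ≅ hyp m E′ → Σ (n ≡ m) λ { refl → ∃ (IsIsomorphism E E′) }
  ≅⇒isomorphism {n} {m} {E} {E′} G≅H with n ≟ m
  ... | yes refl
    with f , injᵇ∧preserves ← satisfied (any⁻ _ (allMaps n n) (Equivalence.from T-≡ G≅H))
    with injᵇ , preserves ← Equivalence.to T-∧ injᵇ∧preserves
    = refl , f , injectiveᵇ⁻ f injᵇ ,
      λ S → Equivalence.to (T-does (isEdge (hyp n E) S Bool.≟ _)) (All.lookup (all⁺ _ _ preserves) (∈-allSubsets S))

  isomorphism⇒≅ : ∀ {n E E′} → ∃ (IsIsomorphism E E′) → hyp n E ≅ hyp n E′
  isomorphism⇒≅ {n} {E} {E′} (f , inj , preserves) rewrite ≟-diag (refl {x = n}) =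
    Equivalence.to T-≡ (any⁺ _ (lose (∈-allMaps f) (Equivalence.from T-∧ (injectiveᵇ⁺ f inj ,
      all⁻ _ {allSubsets n} (All.tabulate (λ {S} _ → Equivalence.from (T-does (isEdge (hyp n E) S Bool.≟ _)) (preserves S)))))))

  identity : ∀ {m} → VertexMap m
  identity = tabulate (λ i → i)

  compose : ∀ {m} → VertexMap m → VertexMap m → VertexMap m
  compose f g = tabulate (λ i → lookup g (lookup f i))

  image-identity : ∀ {m} (S : Subset m) → image identity S ≡ S
  image-identity S = Subset-ext
    (λ j h → let i , Si , i≡j = image⁻ identity S j h in
             subst (T ∘ lookup S) (trans (sym (lookup∘tabulate (λ i → i) i)) i≡j) Si)
    (λ j Sj → subst (T ∘ lookup (image identity S)) (lookup∘tabulate (λ i → i) j) (image⁺ identity S j Sj))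

  image-compose : ∀ {m} (f g : VertexMap m) S → image (compose f g) S ≡ image g (image f S)
  image-compose f g S = Subset-ext
    (λ j h → let i , Si , gfi≡j = image⁻ (compose f g) S j h in
             subst (T ∘ lookup (image g (image f S))) (trans (sym (lookup∘tabulate _ i)) gfi≡j)
                   (image⁺ g (image f S) (lookup f i) (image⁺ f S i Si)))
    (λ j h → let k , fSk , gk≡j = image⁻ g (image f S) j h
                 i , Si , fi≡k = image⁻ f S k fSk in
             subst (T ∘ lookup (image (compose f g) S))
                   (trans (lookup∘tabulate _ i) (trans (cong (lookup g) fi≡k) gk≡j))
                   (image⁺ (compose f g) S i Si))

  injective⇒surjective : ∀ {m} (f : VertexMap m) → Injectiveᵛ f → ∀ j → ∃ λ i → lookup f i ≡ j
  injective⇒surjective {suc m} f inj j with any? (λ i → lookup f i Fin.≟ j)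
  ... | yes j∈image = j∈image
  ... | no j∉image = ⊥-elim (<-irrefl refl (injective⇒≤ {f = punchOut ∘ avoids} (inj ∘ punchOut-injective (avoids _) (avoids _))))
    where
    avoids : ∀ i → j ≢ lookup f i
    avoids i j≡fi = j∉image (i , sym j≡fi)

  ≅-refl : ∀ {G} → G ≅ G
  ≅-refl {hyp n E} = isomorphism⇒≅ (identity , inj , λ S → cong (isEdge (hyp n E)) (sym (image-identity S)))
    where
    inj : Injectiveᵛ identity
    inj {i} {j} e = trans (sym (lookup∘tabulate (λ i → i) i)) (trans e (lookup∘tabulate (λ i → i) j))

  ≅-trans : ∀ {G H K} → G ≅ H → H ≅ K → G ≅ K
  ≅-trans {hyp n E} {hyp m E′} {hyp k E″} G≅H H≅K
    with refl , f , f-inj , f-preserves ← ≅⇒isomorphism {n} {m} {E} {E′} G≅H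
    with refl , g , g-inj , g-preserves ← ≅⇒isomorphism {m} {k} {E′} {E″} H≅K
    = isomorphism⇒≅ (compose f g , inj ,
        λ S → trans (f-preserves S) (trans (g-preserves (image f S)) (cong (isEdge (hyp n E″)) (sym (image-compose f g S)))))
    where
    inj : Injectiveᵛ (compose f g)
    inj {i} {j} e = f-inj (g-inj (trans (sym (lookup∘tabulate _ i)) (trans e (lookup∘tabulate _ j))))

  ≅-sym : ∀ {G H} → G ≅ H → H ≅ G
  ≅-sym {hyp n E} {hyp m E′} G≅H with refl , f , f-inj , f-preserves ← ≅⇒isomorphism {n} {m} {E} {E′} G≅H =
    isomorphism⇒≅ (g , g-inj , λ S → sym (trans (f-preserves (image g S)) (cong (isEdge (hyp n E′)) (image-f∘g S))))
    where
    g : VertexMap n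
    g = tabulate (λ j → proj₁ (injective⇒surjective f f-inj j))

    f∘g : ∀ j → lookup f (lookup g j) ≡ j
    f∘g j = trans (cong (lookup f) (lookup∘tabulate _ j)) (proj₂ (injective⇒surjective f f-inj j))

    g-inj : Injectiveᵛ g
    g-inj {i} {j} e = trans (sym (f∘g i)) (trans (cong (lookup f) e) (f∘g j))

    image-f∘g : ∀ S → image f (image g S) ≡ S
    image-f∘g S = Subset-ext
      (λ j h → let i , gSi , fi≡j = image⁻ f (image g S) j h
                   k , Sk , gk≡i = image⁻ g S i gSi in
               subst (T ∘ lookup S) (trans (sym (f∘g k)) (trans (cong (lookup f) gk≡i) fi≡j)) Sk)
      (λ j Sj → subst (T ∘ lookup (image f (image g S))) (f∘g j) (image⁺ f (image g S) (lookup g j) (image⁺ g S j Sj)))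

  ≅⇒≡n : ∀ {G H} → G ≅ H → n G ≡ n H
  ≅⇒≡n {hyp n E} {hyp m E′} G≅H = proj₁ (≅⇒isomorphism {n} {m} {E} {E′} G≅H)

  ≅-isEquivalence : IsEquivalence _≅_
  ≅-isEquivalence = record
    { refl  = λ {G} → ≅-refl {G}
    ; sym   = λ {G} {H} → ≅-sym {G} {H}
    ; trans = λ {G} {H} {K} → ≅-trans {G} {H} {K}
    }

module Sums {c ℓ} (K : Field c ℓ) where

  open Field K
  open FieldOps K using (fromℕ)
  open Space K using (Σ[_]; [_])
  open import Algebra.Properties.Group +-group using (ε⁻¹≈ε)
  open import Algebra.Properties.AbelianGroup +-abelianGroup using (⁻¹-∙-comm)
  open import Algebra.Solver.Ring.NaturalCoefficients commutativeSemiring (λ _ _ → nothing)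

  private variable
    a b : Level
    A : Set a
    B : Set b

  Σ-cong : ∀ xs {f g : A → Carrier} → (∀ x → f x ≈ g x) → Σ[ xs ] f ≈ Σ[ xs ] g
  Σ-cong []       f≈g = refl
  Σ-cong (x ∷ xs) f≈g = +-cong (f≈g x) (Σ-cong xs f≈g)

  Σ-++ : ∀ xs ys (f : A → Carrier) → Σ[ xs ++ ys ] f ≈ Σ[ xs ] f + Σ[ ys ] f
  Σ-++ []       ys f = sym (+-identityˡ _)
  Σ-++ (x ∷ xs) ys f = trans (+-congˡ (Σ-++ xs ys f)) (sym (+-assoc _ _ _))

  Σ-*ˡ : ∀ xs k (f : A → Carrier) → Σ[ xs ] (λ x → k * f x) ≈ k * Σ[ xs ] f
  Σ-*ˡ []       k f = sym (zeroʳ k)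
  Σ-*ˡ (x ∷ xs) k f = trans (+-congˡ (Σ-*ˡ xs k f)) (sym (distribˡ k _ _))

  Σ-*ʳ : ∀ xs (f : A → Carrier) k → Σ[ xs ] (λ x → f x * k) ≈ Σ[ xs ] f * k
  Σ-*ʳ []       f k = sym (zeroˡ k)
  Σ-*ʳ (x ∷ xs) f k = trans (+-congˡ (Σ-*ʳ xs f k)) (sym (distribʳ k _ _))

  Σ-1 : ∀ (xs : List A) → Σ[ xs ] (λ _ → 1#) ≈ fromℕ (length xs)
  Σ-1 []       = refl
  Σ-1 (x ∷ xs) = +-congˡ (Σ-1 xs)

  Σ-+ : ∀ xs (f g : A → Carrier) → Σ[ xs ] (λ x → f x + g x) ≈ Σ[ xs ] f + Σ[ xs ] g
  Σ-+ []       f g = sym (+-identityˡ _)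
  Σ-+ (x ∷ xs) f g = trans (+-congˡ (Σ-+ xs f g))
    (solve 4 (λ a b c d → (a :+ b) :+ (c :+ d) := (a :+ c) :+ (b :+ d)) refl _ _ _ _)

  Σ-negate : ∀ xs (f : A → Carrier) → Σ[ xs ] (λ x → - f x) ≈ - Σ[ xs ] f
  Σ-negate []       f = sym ε⁻¹≈ε
  Σ-negate (x ∷ xs) f = trans (+-congˡ (Σ-negate xs f)) (⁻¹-∙-comm _ _)

  Σ-indicator : ∀ xs (p : A → Bool) → Σ[ xs ] (λ x → [ p x ]) ≈ fromℕ (length (filterᵇ p xs))
  Σ-indicator [] p = refl
  Σ-indicator (x ∷ xs) p with p x
  ... | true  = +-congˡ (Σ-indicator xs p)
  ... | false = trans (+-identityˡ _) (Σ-indicator xs p)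

  Σ-map : ∀ (h : A → B) xs (f : B → Carrier) → Σ[ map h xs ] f ≈ Σ[ xs ] (f ∘′ h)
  Σ-map h []       f = refl
  Σ-map h (x ∷ xs) f = +-congˡ (Σ-map h xs f)

  Σ-concatMap : ∀ (h : A → List B) xs (f : B → Carrier) → Σ[ concatMap h xs ] f ≈ Σ[ xs ] (λ x → Σ[ h x ] f)
  Σ-concatMap h []       f = refl
  Σ-concatMap h (x ∷ xs) f = trans (Σ-++ (h x) (concatMap h xs) f) (+-congˡ (Σ-concatMap h xs f))

odd≢even : ∀ a b → suc (a +ℕ a) ≢ b +ℕ b
odd≢even zero    (suc b) 1≡b+b with () ← ≡.trans (suc-injective 1≡b+b) (+-suc b b)
odd≢even (suc a) (suc b) a+a≡b+b rewrite +-suc a a | +-suc b b = odd≢even a b (suc-injective (suc-injective a+a≡b+b))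

module Parity {c ℓ} (K : Field c ℓ) where

  open Field K
  open FieldOps K using (fromℕ; IsInteger)
  open import Algebra.Properties.Group +-group using (∙-cancelˡ)
  open import Algebra.Solver.Ring.NaturalCoefficients commutativeSemiring (λ _ _ → nothing)
  open import Relation.Binary.Reasoning.Setoid setoid

  -- The image of ℤ in K, through natural numbers so that no sign cases arise.
  Integral : Carrier → Set ℓ
  Integral x = ∃₂ λ m n → x + fromℕ n ≈ fromℕ m

  Even : Carrier → Set (c ⊔ ℓ)
  Even y = ∃ λ z → Integral z × y ≈ z + z

  fromℕ-+ : ∀ m n → fromℕ (m +ℕ n) ≈ fromℕ m + fromℕ n
  fromℕ-+ zero    n = sym (+-identityˡ _)
  fromℕ-+ (suc m) n = trans (+-congˡ (fromℕ-+ m n)) (sym (+-assoc _ _ _))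

  fromℕ-* : ∀ m n → fromℕ (m *ℕ n) ≈ fromℕ m * fromℕ n
  fromℕ-* zero    n = sym (zeroˡ _)
  fromℕ-* (suc m) n = begin
    fromℕ (n +ℕ m *ℕ n)            ≈⟨ trans (fromℕ-+ n (m *ℕ n)) (+-congˡ (fromℕ-* m n)) ⟩
    fromℕ n + fromℕ m * fromℕ n    ≈⟨ solve 2 (λ n m → n :+ m :* n := (con 1 :+ m) :* n) refl _ _ ⟩
    (1# + fromℕ m) * fromℕ n       ∎

  fromℕ-integral : ∀ n → Integral (fromℕ n)
  fromℕ-integral n = n , 0 , +-identityʳ _

  integer⇒integral : ∀ {x} → IsInteger x → Integral x
  integer⇒integral (+ n      , x≈n)  = n , 0 , trans (+-identityʳ _) x≈n
  integer⇒integral (-[1+ n ] , x≈-n) = 0 , suc n , trans (+-congʳ x≈-n) (-‿inverseˡ _)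

  integral-resp : ∀ {x y} → x ≈ y → Integral x → Integral y
  integral-resp x≈y (m , n , x+n≈m) = m , n , trans (+-congʳ (sym x≈y)) x+n≈m

  integral-+ : ∀ {x y} → Integral x → Integral y → Integral (x + y)
  integral-+ {x} {y} (m , n , x+n≈m) (m′ , n′ , y+n′≈m′) = m +ℕ m′ , n +ℕ n′ , (begin
    (x + y) + fromℕ (n +ℕ n′)           ≈⟨ +-congˡ (fromℕ-+ n n′) ⟩
    (x + y) + (fromℕ n + fromℕ n′)      ≈⟨ solve 4 (λ x y n n′ → (x :+ y) :+ (n :+ n′) := (x :+ n) :+ (y :+ n′)) refl x y _ _ ⟩
    (x + fromℕ n) + (y + fromℕ n′)      ≈⟨ +-cong x+n≈m y+n′≈m′ ⟩
    fromℕ m + fromℕ m′                  ≈⟨ fromℕ-+ m m′ ⟨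
    fromℕ (m +ℕ m′)                     ∎)

  -- (x + n)(y + n′) = m m′ turns into x y + (m n′ + n m′) = m m′ + n n′.
  integral-* : ∀ {x y} → Integral x → Integral y → Integral (x * y)
  integral-* {x} {y} (m , n , x+n≈m) (m′ , n′ , y+n′≈m′) = m *ℕ m′ +ℕ n *ℕ n′ , m *ℕ n′ +ℕ n *ℕ m′ , (begin
    x * y + fromℕ (m *ℕ n′ +ℕ n *ℕ m′)     ≈⟨ +-congˡ (products m n′ n m′) ⟩
    x * y + (M * N′ + N * M′)             ≈⟨ +-congˡ (+-cong (*-congʳ (sym x+n≈m)) (*-congˡ (sym y+n′≈m′))) ⟩
    x * y + ((x + N) * N′ + N * (y + N′)) ≈⟨ solve 4 (λ x y N N′ → x :* y :+ ((x :+ N) :* N′ :+ N :* (y :+ N′)) := (x :+ N) :* (y :+ N′) :+ N :* N′) refl x y N N′ ⟩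
    (x + N) * (y + N′) + N * N′           ≈⟨ +-congʳ (*-cong x+n≈m y+n′≈m′) ⟩
    M * M′ + N * N′                       ≈⟨ products m m′ n n′ ⟨
    fromℕ (m *ℕ m′ +ℕ n *ℕ n′)            ∎)
    where
    M = fromℕ m ; N = fromℕ n ; M′ = fromℕ m′ ; N′ = fromℕ n′
    products : ∀ a b c d → fromℕ (a *ℕ b +ℕ c *ℕ d) ≈ fromℕ a * fromℕ b + fromℕ c * fromℕ d
    products a b c d = trans (fromℕ-+ (a *ℕ b) (c *ℕ d)) (+-cong (fromℕ-* a b) (fromℕ-* c d))

  even-resp : ∀ {x y} → x ≈ y → Even x → Even y
  even-resp x≈y (z , z-integral , x≈z+z) = z , z-integral , trans (sym x≈y) x≈z+z

  even-0 : Even 0#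
  even-0 = 0# , fromℕ-integral 0 , sym (+-identityˡ _)

  even-+ : ∀ {x y} → Even x → Even y → Even (x + y)
  even-+ {x} {y} (z , z-integral , x≈z+z) (z′ , z′-integral , y≈z′+z′) = z + z′ , integral-+ z-integral z′-integral ,
    trans (+-cong x≈z+z y≈z′+z′) (solve 2 (λ z z′ → (z :+ z) :+ (z′ :+ z′) := (z :+ z′) :+ (z :+ z′)) refl z z′)

  fromℕ-injective : CharacteristicZero K → ∀ m n → fromℕ m ≈ fromℕ n → m ≡ n
  fromℕ-injective char0 zero    zero    _ = ≡.refl
  fromℕ-injective char0 zero    (suc n) 0≈n = ⊥-elim (char0 n (sym 0≈n))
  fromℕ-injective char0 (suc m) zero    m≈0 = ⊥-elim (char0 m m≈0)
  fromℕ-injective char0 (suc m) (suc n) m≈n = ≡.cong suc (fromℕ-injective char0 m n (∙-cancelˡ 1# _ _ m≈n))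

  odd-¬even : CharacteristicZero K → ∀ k → ¬ Even (fromℕ (suc (k +ℕ k)))
  odd-¬even char0 k (z , (m , n , z+n≈m) , odd≈z+z) =
    odd≢even (k +ℕ n) m (fromℕ-injective char0 _ _ (begin
      1# + fromℕ ((k +ℕ n) +ℕ (k +ℕ n))   ≈⟨ +-congˡ (trans (fromℕ-+ (k +ℕ n) _) (+-cong (fromℕ-+ k n) (fromℕ-+ k n))) ⟩
      1# + ((k′ + N) + (k′ + N))            ≈⟨ solve 3 (λ K N o → o :+ ((K :+ N) :+ (K :+ N)) := (o :+ (K :+ K)) :+ (N :+ N)) refl k′ N 1# ⟩
      (1# + (k′ + k′)) + (N + N)            ≈⟨ +-congʳ (trans (+-congˡ (sym (fromℕ-+ k k))) odd≈z+z) ⟩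
      (z + z) + (N + N)                   ≈⟨ solve 2 (λ z N → (z :+ z) :+ (N :+ N) := (z :+ N) :+ (z :+ N)) refl z N ⟩
      (z + N) + (z + N)                   ≈⟨ +-cong z+n≈m z+n≈m ⟩
      fromℕ m + fromℕ m                   ≈⟨ fromℕ-+ m m ⟨
      fromℕ (m +ℕ m)                      ∎))
    where
    k′ = fromℕ k ; N = fromℕ n

Holds : ∀ {A : Set} → (A → A → Bool) → A → A → Set
Holds R a b = R a b ≡ true

-- Equality of formal sums (≈₁, ≈₂, ≈₃) only compares coefficients of isomorphism classes, so a
-- class function is evaluated on a formal sum by regrouping the sum class by class.
module FormalSums {c ℓ} (K : Field c ℓ) {A : Set} (_∼_ : A → A → Bool)
                  (∼-isEquivalence : IsEquivalence (Holds _∼_)) where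

  open Field K
  open Space K using (Σ[_]; [_])
  open Sums K
  open Parity K
  open IsEquivalence ∼-isEquivalence using () renaming (refl to ∼-refl; sym to ∼-sym; trans to ∼-trans)
  open import Algebra.Properties.Group +-group using (x∙y⁻¹≈ε⇒x≈y; x≈y⇒x∙y⁻¹≈ε)
  open import Algebra.Properties.Ring ring using (-‿distribˡ-*)
  open import Algebra.Solver.Ring.NaturalCoefficients commutativeSemiring (λ _ _ → nothing)
  open import Relation.Binary.Reasoning.Setoid setoid

  FormalSum : Set c
  FormalSum = List (Carrier × A)

  eval : (A → Carrier) → FormalSum → Carrier
  eval F x = Σ[ x ] (λ p → proj₁ p * F (proj₂ p))

  coeff : FormalSum → A → Carrier
  coeff x t = eval (λ b → [ b ∼ t ]) x

  Respects : (A → Carrier) → Set ℓ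
  Respects F = ∀ a b → (a ∼ b) ≡ true → F a ≈ F b

  eval-≗ : ∀ {F G} → (∀ t → F t ≈ G t) → ∀ x → eval F x ≈ eval G x
  eval-≗ F≈G x = Σ-cong x (λ p → *-congˡ (F≈G (proj₂ p)))

  eval-+ : ∀ F G x → eval (λ t → F t + G t) x ≈ eval F x + eval G x
  eval-+ F G x = trans (Σ-cong x (λ p → distribˡ (proj₁ p) _ _)) (Σ-+ x _ _)

  removeClass : A → FormalSum → FormalSum
  removeClass a = filterᵇ (λ p → not (proj₂ p ∼ a))

  eval-removeClass : ∀ {F} → Respects F → ∀ a x → eval F x ≈ coeff x a * F a + eval F (removeClass a x)
  eval-removeClass F-resp a [] = sym (trans (+-identityʳ _) (zeroˡ _))
  eval-removeClass {F} F-resp a ((c , b) ∷ x) with b ∼ a in b∼a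
  ... | true = begin
    c * F b + eval F x                                      ≈⟨ +-cong (*-congˡ (F-resp b a b∼a)) (eval-removeClass F-resp a x) ⟩
    c * F a + (coeff x a * F a + eval F (removeClass a x)) ≈⟨ solve 4 (λ c f k s → c :* f :+ (k :* f :+ s) := (c :* con 1 :+ k) :* f :+ s) refl c (F a) _ _ ⟩
    (c * 1# + coeff x a) * F a + eval F (removeClass a x)  ∎
  ... | false = begin
    c * F b + eval F x                                      ≈⟨ +-congˡ (eval-removeClass F-resp a x) ⟩
    c * F b + (coeff x a * F a + eval F (removeClass a x)) ≈⟨ solve 3 (λ g kf s → g :+ (kf :+ s) := kf :+ (g :+ s)) refl _ _ _ ⟩
    coeff x a * F a + (c * F b + eval F (removeClass a x)) ≈⟨ +-congʳ (*-congʳ (sym (trans (+-congʳ (zeroʳ c)) (+-identityˡ _)))) ⟩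
    (c * 0# + coeff x a) * F a + (c * F b + eval F (removeClass a x)) ∎

  coeff-removeClass-∼ : ∀ {t a} → (t ∼ a) ≡ true → ∀ x → coeff (removeClass a x) t ≈ 0#
  coeff-removeClass-∼ t∼a [] = refl
  coeff-removeClass-∼ {t} {a} t∼a ((c , b) ∷ x) with b ∼ a in b∼a
  ... | true = coeff-removeClass-∼ t∼a x
  ... | false with b ∼ t in b∼t
  ...   | true with () ← ≡.trans (≡.sym b∼a) (∼-trans b∼t t∼a)
  ...   | false = trans (+-cong (zeroʳ c) (coeff-removeClass-∼ t∼a x)) (+-identityʳ _)

  coeff-removeClass-≁ : ∀ {t a} → (t ∼ a) ≡ false → ∀ x → coeff (removeClass a x) t ≈ coeff x t
  coeff-removeClass-≁ t≁a [] = refl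
  coeff-removeClass-≁ {t} {a} t≁a ((c , b) ∷ x) with b ∼ a in b∼a
  ... | false = +-congˡ (coeff-removeClass-≁ t≁a x)
  ... | true with b ∼ t in b∼t
  ...   | true with () ← ≡.trans (≡.sym t≁a) (∼-trans (∼-sym b∼t) b∼a)
  ...   | false = trans (coeff-removeClass-≁ t≁a x) (sym (trans (+-congʳ (zeroʳ c)) (+-identityˡ _)))

  length-removeClass : ∀ c a x → length (removeClass a ((c , a) ∷ x)) ≤ length x
  length-removeClass c a x rewrite ∼-refl {a} = length-filter (T? ∘ (λ p → not (proj₂ p ∼ a))) x

  module _ {F : A → Carrier} (F-resp : Respects F)
           {p q} (P : Carrier → Set p) (Q : Carrier → Set q)
           (P-resp : ∀ {x y} → x ≈ y → P x → P y) (P-0 : P 0#)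
           (P-step : ∀ {k s} a → Q k → P s → P (k * F a + s))
           (Q-resp : ∀ {x y} → x ≈ y → Q x → Q y) (Q-0 : Q 0#) where

    eval-by-classes : ∀ x → (∀ t → Q (coeff x t)) → P (eval F x)
    eval-by-classes x = go (length x) x ≤-refl
      where
      go : ∀ n x → length x ≤ n → (∀ t → Q (coeff x t)) → P (eval F x)
      go _       []               _         _  = P-0
      go (suc n) x@((c , a) ∷ x′) (s≤s len) Qx =
        P-resp (sym (eval-removeClass F-resp a x))
          (P-step a (Qx a) (go n (removeClass a x) (≤-trans (length-removeClass c a x′) len) Q-removed))
        where
        Q-removed : ∀ t → Q (coeff (removeClass a x) t)
        Q-removed t with t ∼ a in t∼a
        ... | true  = Q-resp (sym (coeff-removeClass-∼ t∼a x)) Q-0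
        ... | false = Q-resp (sym (coeff-removeClass-≁ t∼a x)) (Qx t)

  eval-≈0 : ∀ {F} → Respects F → ∀ x → (∀ t → coeff x t ≈ 0#) → eval F x ≈ 0#
  eval-≈0 F-resp = eval-by-classes F-resp (_≈ 0#) (_≈ 0#) ≈0-resp refl
    (λ _ k≈0 s≈0 → trans (+-cong (trans (*-congʳ k≈0) (zeroˡ _)) s≈0) (+-identityʳ _)) ≈0-resp refl
    where
    ≈0-resp : ∀ {x y} → x ≈ y → x ≈ 0# → y ≈ 0#
    ≈0-resp x≈y x≈0 = trans (sym x≈y) x≈0

  eval-double-even : ∀ {w} → Respects w → (∀ t → Integral (w t)) →
                     ∀ x → (∀ t → Integral (coeff x t)) → Even (eval (λ t → w t + w t) x)
  eval-double-even {w} w-resp w-integral =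
    eval-by-classes (λ a b a∼b → +-cong (w-resp a b a∼b) (w-resp a b a∼b)) Even Integral even-resp even-0
      (λ a k-integral s-even → even-+ (_ , integral-* k-integral (w-integral a) , distribˡ _ _ _) s-even)
      integral-resp (fromℕ-integral 0)

  negate : FormalSum → FormalSum
  negate = map (map₁ (-_))

  eval-negate : ∀ F y → eval F (negate y) ≈ - eval F y
  eval-negate F y = trans (Σ-map _ y _) (trans (Σ-cong y (λ p → sym (-‿distribˡ-* _ _))) (Σ-negate y _))

  eval-cong : ∀ {F} → Respects F → ∀ x y → (∀ t → coeff x t ≈ coeff y t) → eval F x ≈ eval F y
  eval-cong {F} F-resp x y x≈y = x∙y⁻¹≈ε⇒x≈y _ _ (begin
    eval F x - eval F y              ≈⟨ +-congˡ (eval-negate F y) ⟨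
    eval F x + eval F (negate y)     ≈⟨ Σ-++ x (negate y) _ ⟨
    eval F (x ++ negate y)           ≈⟨ eval-≈0 F-resp (x ++ negate y) coeff≈0 ⟩
    0#                               ∎)
    where
    coeff≈0 : ∀ t → coeff (x ++ negate y) t ≈ 0#
    coeff≈0 t = trans (Σ-++ x (negate y) _) (trans (+-congˡ (eval-negate _ y)) (x≈y⇒x∙y⁻¹≈ε (x≈y t)))

_∧ᴿ_ : ∀ {A B : Set} → (A → A → Bool) → (B → B → Bool) → (A × B → A × B → Bool)
(R ∧ᴿ S) p q = R (proj₁ p) (proj₁ q) ∧ S (proj₂ p) (proj₂ q)

∧ᴿ-isEquivalence : ∀ {A B : Set} {R : A → A → Bool} {S : B → B → Bool} →
                   IsEquivalence (Holds R) → IsEquivalence (Holds S) → IsEquivalence (Holds (R ∧ᴿ S))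
∧ᴿ-isEquivalence R-equiv S-equiv = record
  { refl  = cong₂ _∧_ R.refl S.refl
  ; sym   = λ h → cong₂ _∧_ (R.sym (∧-conicalˡ _ _ h)) (S.sym (∧-conicalʳ _ _ h))
  ; trans = λ h k → cong₂ _∧_ (R.trans (∧-conicalˡ _ _ h) (∧-conicalˡ _ _ k)) (S.trans (∧-conicalʳ _ _ h) (∧-conicalʳ _ _ k))
  }
  where
  module R = IsEquivalence R-equiv
  module S = IsEquivalence S-equiv

length-allSubsets : ∀ k → length (allSubsets (suc k)) ≡ length (allSubsets k) +ℕ length (allSubsets k)
length-allSubsets k = ≡.trans (length-++ (map (true ∷_) (allSubsets k)))
                              (cong₂ _+ℕ_ (length-map _ (allSubsets k)) (length-map _ (allSubsets k)))

hyperedge₃ : Hyp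
hyperedge₃ = hyp 3 λ { (true ∷ true ∷ true ∷ []) → true ; _ → false }

module Coproduct {c ℓ} (K : Field c ℓ) where

  open Field K
  open FieldOps K
  open Space K
  open Sums K
  open Parity K using (fromℕ-+)
  open import Relation.Binary.Reasoning.Setoid setoid

  halfSubsets : ℕ → ℕ
  halfSubsets zero    = 0
  halfSubsets (suc k) = length (allSubsets k)

  λ₀⊗λ₀∘Δ : ∀ H → Σ[ Δ H ] proj₁ ≈ εΔ H + (fromℕ (halfSubsets (n H)) + fromℕ (halfSubsets (n H)))
  λ₀⊗λ₀∘Δ (hyp zero    E) = +-congˡ (sym (+-identityˡ 0#))
  λ₀⊗λ₀∘Δ (hyp (suc k) E) = begin
    Σ[ Δ (hyp (suc k) E) ] proj₁                       ≈⟨ trans (Σ-map _ (allSubsets (suc k)) proj₁) (Σ-1 (allSubsets (suc k))) ⟩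
    fromℕ (length (allSubsets (suc k)))                ≈⟨ reflexive (≡.cong fromℕ (length-allSubsets k)) ⟩
    fromℕ (length (allSubsets k) +ℕ length (allSubsets k)) ≈⟨ fromℕ-+ (length (allSubsets k)) _ ⟩
    fromℕ (length (allSubsets k)) + fromℕ (length (allSubsets k)) ≈⟨ +-identityˡ _ ⟨
    0# + (fromℕ (length (allSubsets k)) + fromℕ (length (allSubsets k))) ∎

  εΔ-nonempty : ∀ k E → εΔ (hyp (suc k) E) ≈ 0#
  εΔ-nonempty zero    E = refl
  εΔ-nonempty (suc k) E = refl

  trivialSplits : Hyp → Carrier
  trivialSplits G = Σ[ allSubsets (n G) ] (λ I → εδ (restr⊂ G I ⊔ₕ restr∩ G (∁ I)))

  -- Exactly the three 2-element I qualify: for |I| = 3 the edge {0,1,2} lies in G|⊂I, and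
  -- for |I| ≤ 1 it meets V ∖ I in an edge of size ≥ 2.
  trivialSplits-hyperedge₃ : trivialSplits hyperedge₃ ≈ fromℕ 3
  trivialSplits-hyperedge₃ = Σ-indicator (allSubsets 3) (λ I → εδᵇ (restr⊂ hyperedge₃ I ⊔ₕ restr∩ hyperedge₃ (∁ I)))

module ConsequencesOfConditions {c ℓ} (K : Field c ℓ) (δ : Space.Cop K) (C : Space.Conditions K δ) where

  open Field K
  open FieldOps K
  open Space K
  open Sums K
  open Parity K
  open Isomorphism using (≅-isEquivalence; ≅⇒≡n)
  open Coproduct K
  open Conditions C
  open IsDoubleBialgebra double
  open IsBialgebra bialg-d
  open import Algebra.Solver.Ring.NaturalCoefficients commutativeSemiring (λ _ _ → nothing)
  open import Relation.Binary.Reasoning.Setoid setoid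

  module ≅¹ = FormalSums K isoᵇ ≅-isEquivalence
  module ≅² = FormalSums K (isoᵇ ∧ᴿ isoᵇ) (∧ᴿ-isEquivalence ≅-isEquivalence ≅-isEquivalence)
  module ≅³ = FormalSums K (isoᵇ ∧ᴿ (isoᵇ ∧ᴿ isoᵇ))
                (∧ᴿ-isEquivalence ≅-isEquivalence (∧ᴿ-isEquivalence ≅-isEquivalence ≅-isEquivalence))

  μ : LinForm
  μ = inv

  λ₀⊗μ : Hyp × Hyp → Carrier
  λ₀⊗μ t = μ (proj₂ t)

  λ₀⊗λ₀⊗μ : Hyp × Hyp × Hyp → Carrier
  λ₀⊗λ₀⊗μ t = μ (proj₂ (proj₂ t))

  λ₀⊗μ-resp : ≅².Respects λ₀⊗μ
  λ₀⊗μ-resp s t s∼t = inv-wd _ _ (∧-conicalʳ (isoᵇ (proj₁ s) (proj₁ t)) _ s∼t)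

  λ₀⊗λ₀⊗μ-resp : ≅³.Respects λ₀⊗λ₀⊗μ
  λ₀⊗λ₀⊗μ-resp s t s∼t = λ₀⊗μ-resp (proj₂ s) (proj₂ t) (∧-conicalʳ (isoᵇ (proj₁ s) (proj₁ t)) _ s∼t)

  λ₀⋆μ : ∀ X → ≅².eval λ₀⊗μ (δ X) ≈ εδ X
  λ₀⋆μ X = trans (Σ-cong (δ X) (λ p → *-congʳ (sym (*-identityʳ (proj₁ p))))) (inv-left X)

  λ₀⋆μ-⊔ : ∀ A B → ≅².eval λ₀⊗μ (mul₂ (δ A) (δ B)) ≈ εδ (A ⊔ₕ B)
  λ₀⋆μ-⊔ A B = trans (≅².eval-cong λ₀⊗μ-resp (mul₂ (δ A) (δ B)) (δ (A ⊔ₕ B))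
                        (λ t → sym (mult A B (proj₁ t) (proj₂ t))))
                     (λ₀⋆μ (A ⊔ₕ B))

  eval-m13-24 : ∀ G → ≅³.eval λ₀⊗λ₀⊗μ (m13-24 δ G) ≈
                      Σ[ Δ G ] (λ p → proj₁ p * ≅².eval λ₀⊗μ (mul₂ (δ (proj₁ (proj₂ p))) (δ (proj₂ (proj₂ p)))))
  eval-m13-24 G = trans (Σ-concatMap _ (Δ G) _) (Σ-cong (Δ G) λ { (a , A , B) →
    trans (Σ-concatMap _ (δ A) _)
      (trans (Σ-cong (δ A) λ { (b , A₁ , A₂) →
                trans (Σ-map _ (δ B) _)
                  (trans (Σ-cong (δ B) λ { (c , B₁ , B₂) → reassociate a b c (μ (A₂ ⊔ₕ B₂)) })
                     (trans (Σ-*ˡ (δ B) a _) (*-congˡ (sym (Σ-map _ (δ B) _))))) })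
         (trans (Σ-*ˡ (δ A) a _) (*-congˡ (sym (Σ-concatMap _ (δ A) _))))) })
    where
    reassociate : ∀ a b c m → (a * b * c) * m ≈ a * ((b * c) * m)
    reassociate = solve 4 (λ a b c m → (a :* b :* c) :* m := a :* ((b :* c) :* m)) refl

  eval-Δ⊗Id : ∀ x → ≅³.eval λ₀⊗λ₀⊗μ (Δ ⊗Id x) ≈ ≅².eval (λ t → Σ[ Δ (proj₁ t) ] proj₁ * μ (proj₂ t)) x
  eval-Δ⊗Id x = trans (Σ-concatMap _ x _) (Σ-cong x λ { (a , G₁ , G₂) → begin
    Σ[ map _ (Δ G₁) ] _                        ≈⟨ Σ-map _ (Δ G₁) _ ⟩
    Σ[ Δ G₁ ] (λ q → (a * proj₁ q) * μ G₂)    ≈⟨ Σ-cong (Δ G₁) (λ q → *-assoc a (proj₁ q) (μ G₂)) ⟩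
    Σ[ Δ G₁ ] (λ q → a * (proj₁ q * μ G₂))    ≈⟨ Σ-*ˡ (Δ G₁) a _ ⟩
    a * Σ[ Δ G₁ ] (λ q → proj₁ q * μ G₂)      ≈⟨ *-congˡ (Σ-*ʳ (Δ G₁) proj₁ (μ G₂)) ⟩
    a * (Σ[ Δ G₁ ] proj₁ * μ G₂)              ∎ })

  εΔ⊗μ∘δ : ∀ G → ≅².eval (λ t → εΔ (proj₁ t) * μ (proj₂ t)) (δ G) ≈ εΔ G * μ 𝟙
  εΔ⊗μ∘δ G = begin
    ≅².eval (λ t → εΔ (proj₁ t) * μ (proj₂ t)) (δ G) ≈⟨ Σ-cong (δ G) (λ p → *-assoc (proj₁ p) _ _) ⟨
    Σ[ δ G ] (λ p → (proj₁ p * εΔ (proj₁ (proj₂ p))) * μ (proj₂ (proj₂ p))) ≈⟨ Σ-map _ (δ G) _ ⟨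
    ≅¹.eval μ (εΔ ⊗Idε δ G)                          ≈⟨ ≅¹.eval-cong inv-wd (εΔ ⊗Idε δ G) ((εΔ G , 𝟙) ∷ []) (εΔ-compat G) ⟩
    εΔ G * μ 𝟙 + 0#                                   ≈⟨ +-identityʳ _ ⟩
    εΔ G * μ 𝟙                                        ∎

  eval-m13-24≈trivialSplits : ∀ G → ≅³.eval λ₀⊗λ₀⊗μ (m13-24 δ G) ≈ trivialSplits G
  eval-m13-24≈trivialSplits G = begin
    ≅³.eval λ₀⊗λ₀⊗μ (m13-24 δ G)                                           ≈⟨ eval-m13-24 G ⟩
    Σ[ Δ G ] (λ p → proj₁ p * ≅².eval λ₀⊗μ (mul₂ (δ (proj₁ (proj₂ p))) (δ (proj₂ (proj₂ p))))) ≈⟨ Σ-cong (Δ G) (λ p → *-congˡ (λ₀⋆μ-⊔ _ _)) ⟩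
    Σ[ Δ G ] (λ p → proj₁ p * εδ (proj₁ (proj₂ p) ⊔ₕ proj₂ (proj₂ p)))       ≈⟨ Σ-map _ (allSubsets (n G)) _ ⟩
    Σ[ allSubsets (n G) ] (λ I → 1# * εδ (restr⊂ G I ⊔ₕ restr∩ G (∁ I)))    ≈⟨ Σ-cong (allSubsets (n G)) (λ I → *-identityˡ _) ⟩
    trivialSplits G                                                          ∎

  half⊗μ : Hyp × Hyp → Carrier
  half⊗μ t = fromℕ (halfSubsets (n (proj₁ t))) * μ (proj₂ t)

  half⊗μ-resp : ≅².Respects half⊗μ
  half⊗μ-resp s t s∼t =
    *-cong (reflexive (≡.cong (fromℕ ∘ halfSubsets) (≅⇒≡n {proj₁ s} {proj₁ t} (∧-conicalˡ _ _ s∼t))))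
           (λ₀⊗μ-resp s t s∼t)

  half⊗μ-integral : ∀ t → Integral (half⊗μ t)
  half⊗μ-integral t = integral-* (fromℕ-integral (halfSubsets (n (proj₁ t)))) (integer⇒integral (inv-int (proj₂ t)))

  eval-Δ⊗Id∘δ : ∀ G → ≅³.eval λ₀⊗λ₀⊗μ (Δ ⊗Id δ G) ≈ εΔ G * μ 𝟙 + ≅².eval (λ t → half⊗μ t + half⊗μ t) (δ G)
  eval-Δ⊗Id∘δ G = begin
    ≅³.eval λ₀⊗λ₀⊗μ (Δ ⊗Id δ G)                                  ≈⟨ eval-Δ⊗Id (δ G) ⟩
    ≅².eval (λ t → Σ[ Δ (proj₁ t) ] proj₁ * μ (proj₂ t)) (δ G)   ≈⟨ ≅².eval-≗ split (δ G) ⟩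
    ≅².eval (λ t → εΔ⊗μ t + (half⊗μ t + half⊗μ t)) (δ G)          ≈⟨ ≅².eval-+ εΔ⊗μ _ (δ G) ⟩
    ≅².eval εΔ⊗μ (δ G) + ≅².eval (λ t → half⊗μ t + half⊗μ t) (δ G) ≈⟨ +-congʳ (εΔ⊗μ∘δ G) ⟩
    εΔ G * μ 𝟙 + ≅².eval (λ t → half⊗μ t + half⊗μ t) (δ G)        ∎
    where
    εΔ⊗μ : Hyp × Hyp → Carrier
    εΔ⊗μ t = εΔ (proj₁ t) * μ (proj₂ t)

    split : ∀ t → Σ[ Δ (proj₁ t) ] proj₁ * μ (proj₂ t) ≈ εΔ⊗μ t + (half⊗μ t + half⊗μ t)
    split t = trans (*-congʳ (λ₀⊗λ₀∘Δ (proj₁ t)))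
      (solve 3 (λ e h m → (e :+ (h :+ h)) :* m := e :* m :+ (h :* m :+ h :* m)) refl _ _ _)

  trivialSplits-even : ∀ k E → Even (trivialSplits (hyp (suc k) E))
  trivialSplits-even k E = even-resp (begin
    ≅².eval (λ t → half⊗μ t + half⊗μ t) (δ G)             ≈⟨ trans (+-congʳ (zeroˡ _)) (+-identityˡ _) ⟨
    0# * μ 𝟙 + ≅².eval (λ t → half⊗μ t + half⊗μ t) (δ G)  ≈⟨ +-congʳ (*-congʳ (εΔ-nonempty k E)) ⟨
    εΔ G * μ 𝟙 + ≅².eval (λ t → half⊗μ t + half⊗μ t) (δ G) ≈⟨ eval-Δ⊗Id∘δ G ⟨
    ≅³.eval λ₀⊗λ₀⊗μ (Δ ⊗Id δ G)                           ≈⟨ ≅³.eval-cong λ₀⊗λ₀⊗μ-resp (Δ ⊗Id δ G) (m13-24 δ G)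
                                                               (λ t → compat G (proj₁ t) (proj₁ (proj₂ t)) (proj₂ (proj₂ t))) ⟩
    ≅³.eval λ₀⊗λ₀⊗μ (m13-24 δ G)                          ≈⟨ eval-m13-24≈trivialSplits G ⟩
    trivialSplits G                                        ∎)
    (≅².eval-double-even half⊗μ-resp half⊗μ-integral (δ G) (λ t → integer⇒integral (coeff-int G (proj₁ t) (proj₂ t))))
    where
    G = hyp (suc k) E

proposition2p6 : ∀ {c ℓ} (K : Field c ℓ) → CharacteristicZero K →
                   (δ : Space.Cop K) → ¬ Space.Conditions K δ
proposition2p6 K char0 δ C =
  odd-¬even char0 1 (even-resp trivialSplits-hyperedge₃ (trivialSplits-even 2 (raw hyperedge₃)))
  where
  open Parity K
  open Coproduct K
  open ConsequencesOfConditions K δ C
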